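{- Let $q$ be a prime power, $t\geq 1$ and $i$ integers with $\gcd(i,t)=1$, and let $a,b\in\mathbb{F}_{q^{3t}}^*$ satisfy $\mathrm{N}_{q^{3t}/q^t}(a)\neq -\mathrm{N}_{q^{3t}/q^t}(b)$. For $c\in\mathbb{F}_{q^{3t}}$ put $f_{i,ca,cb}(x)=ca\,x^{q^i}+cb\,x^{q^{2t+i}}$, and let $f=f_{i,a,b}$. If the $\mathbb{F}_q$-linear set $$L_f=\{\langle (x,f(x))\rangle_{\mathbb{F}_{q^{3t}}} : x\in\mathbb{F}_{q^{3t}}^*\}$$ of $\mathrm{PG}(1,q^{3t})$ is not scattered, then there exists $c\in\mathbb{F}_{q^{3t}}^*$ such that $$\frac{f_{i,ca,cb}(x)}{x}\notin\mathbb{F}_{q^t}\quad\text{for every } x\in\mathbb{F}_{q^{3t}}^*.$$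
   Context: For $h\mid m$, $\mathrm{N}_{q^m/q^h}(\alpha)=\alpha^{1+q^h+\dots+q^{m-h}}$ denotes the norm of $\alpha\in\mathbb{F}_{q^m}$ over $\mathbb{F}_{q^h}$. If $V$ is an $r$-dimensional $\mathbb{F}_{q^n}$-vector space and $U$ an $\mathbb{F}_q$-subspace of $V$ of $\mathbb{F}_q$-dimension $k$, the $\mathbb{F}_q$-linear set of rank $k$ defined by $U$ is $L_U=\{\langle u\rangle_{\mathbb{F}_{q^n}} : u\in U\setminus\{0\}\}\subseteq \mathrm{PG}(V,\mathbb{F}_{q^n})$. The weight of a point $\langle v\rangle_{\mathbb{F}_{q^n}}$ is $\dim_{\mathbb{F}_q}(U\cap\langle v\rangle_{\mathbb{F}_{q^n}})$; $L_U$ is scattered if every point of $L_U$ has weight $1$ (equivalently $|L_U|=(q^k-1)/(q-1)$). Here $\mathrm{PG}(1,q^{3t})=\mathrm{PG}(\mathbb{F}_{q^{3t}}^2,\mathbb{F}_{q^{3t}})$ and $L_f$ is the linear set defined by $U=\{(x,f(x)):x\in\mathbb{F}_{q^{3t}}\}$. -}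

module Defs where

open import Level using (0ℓ)
open import Data.Nat as ℕ using (ℕ; zero; suc)
open import Data.Nat.Primality using (Prime)
open import Data.Product using (Σ; ∃; _×_; _,_)
open import Data.List using (List; length; filter)
open import Data.List.Membership.Propositional using (_∈_)
open import Data.List.Relation.Unary.Unique.Propositional using (Unique)
open import Relation.Nullary using (¬_; Dec)
open import Relation.Binary.PropositionalEquality using (_≡_; _≢_)
open import Algebra.Structures using (IsCommutativeRing)

IsPrimePower : ℕ → Set
IsPrimePower q = Σ ℕ λ p → Σ ℕ λ k → Prime p × (1 ℕ.≤ k) × (q ≡ p ℕ.^ k)

record FiniteField : Set₁ where
  infixl 6 _+_
  infixl 7 _*_
  field
    F     : Set
    _+_   : F → F → F
    _*_   : F → F → F
    -_    : F → F
    0#    : F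
    1#    : F
    isCommutativeRing : IsCommutativeRing _≡_ _+_ _*_ -_ 0# 1#
    0≢1   : 0# ≢ 1#
    inv   : ∀ x → x ≢ 0# → Σ F λ y → x * y ≡ 1#
    _≟_   : (x y : F) → Dec (x ≡ y)
    elems : List F
    complete : ∀ x → x ∈ elems
    unique   : Unique elems

  card : ℕ
  card = length elems

  _^_ : F → ℕ → F
  x ^ zero  = 1#
  x ^ suc n = x * (x ^ n)

  -- membership in the subfield F_{q^h} = { y | y^{q^h} = y }
  InSubfield : ℕ → F → Set
  InSubfield Q y = y ^ Q ≡ y

  N3 : (q t : ℕ) → F → F
  N3 q t α = α ^ (1 ℕ.+ q ℕ.^ t ℕ.+ q ℕ.^ (2 ℕ.* t))

  fLin : (q t i : ℕ) → F → F → F → F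
  fLin q t i A B x = A * (x ^ (q ℕ.^ i)) + B * (x ^ (q ℕ.^ (2 ℕ.* t ℕ.+ i)))

  -- weight of the point ⟨(x, f x)⟩ : the set U ∩ ⟨(x,f x)⟩ is
  -- { (y, f y) | f y * x = f x * y }; its number of elements is q^weight.
  pointCount : (F → F) → F → ℕ
  pointCount f x = length (filter (λ y → (f y * x) ≟ (f x * y)) elems)

  -- L_f is scattered: every point has weight 1, i.e. U ∩ ⟨(x,f x)⟩ has q elements
  Scattered : (q : ℕ) → (F → F) → Set
  Scattered q f = ∀ x → x ≢ 0# → pointCount f x ≡ q

-- Argue by contraposition: assume every c ≢ 0 has some x ≢ 0 with c f(x)/x ∈ 𝔽_{q^t}.
-- The norm condition makes f(x) ≢ 0 for x ≢ 0, and f(μx) = μ^{q^i} f(x) for μ ∈ 𝔽_{q^t}.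
-- Count the pairs (z, x) with x ≢ 0 and z f(x)/x ∈ 𝔽_{q^t}ˣ: every x ≢ 0 lies in exactly |𝔽_{q^t}ˣ|
-- of them, while by assumption every z ≢ 0 lies in at least that many (a whole orbit 𝔽_{q^t}ˣ x).
-- So each row is exactly one orbit. For z = x/f(x) this says: if f(y)/y = f(x)/x, then y = μx with
-- μ ∈ 𝔽_{q^t}, whence μ^{q^i} = μ and, as gcd(i, t) = 1, μ ∈ 𝔽_q. Hence the point ⟨(x, f(x))⟩ meets U
-- in the q vectors 𝔽_q x, i.e. L_f is scattered.
module Submission where

open import Level using (0ℓ)
open import Algebra.Bundles using (CommutativeRing)
open import Data.Nat as ℕ using (ℕ; zero; suc; _≤_; _<_; z≤n; s≤s; nonTrivial⇒n>1)
import Data.Nat.Properties as ℕ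
open import Data.Product using (Σ; ∃; _×_; _,_; proj₁; proj₂)
open import Data.Sum using (_⊎_; inj₁; inj₂)
open import Data.Empty using (⊥-elim)
open import Data.List using (List; []; _∷_; length; filter; map; foldr)
open import Data.List.Membership.Propositional using (_∈_)
open import Data.List.Relation.Unary.Any as Any using (here; there)
open import Data.List.Relation.Unary.All as All using (All; []; _∷_)
open import Data.List.Relation.Unary.Unique.Propositional using (Unique)
open import Data.List.Relation.Unary.AllPairs using ([]; _∷_)
import Data.List.Relation.Unary.Unique.Propositional.Properties as Unique
open import Function using (_∘_)
open import Relation.Nullary using (¬_; Dec; yes; no; ¬?)
open import Relation.Nullary.Decidable using (_×-dec_; decidable-stable)
open import Relation.Unary using (Pred; Decidable)
open import Relation.Binary.PropositionalEquality as ≡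
  using (_≡_; _≢_; refl; sym; trans; cong; cong₂; subst; module ≡-Reasoning)

open import Data.Integer using (+_)
open import Data.Nat.GCD using (gcd)
open import Data.Nat.Primality using (prime⇒nonTrivial; prime⇒nonZero)
open import Data.Nat.Tactic.RingSolver using (solve-∀)

open import Defs

1+d^1+e≡1+multiple : ∀ d e → ∃ λ m → suc d ℕ.^ suc e ≡ suc (suc m ℕ.* d)
1+d^1+e≡1+multiple d zero    = 0 , cong suc (trans (ℕ.*-identityʳ d) (sym (ℕ.+-identityʳ d)))
1+d^1+e≡1+multiple d (suc e) with 1+d^1+e≡1+multiple d e
... | m , eq = suc d ℕ.* suc m , trans (cong (suc d ℕ.*_) eq) (expand d m)
  where
  expand : ∀ d m → suc d ℕ.* suc (suc m ℕ.* d) ≡ suc (suc (suc d ℕ.* suc m) ℕ.* d)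
  expand = solve-∀

n+n*n-even : ∀ n → ∃ λ k → n ℕ.+ n ℕ.* n ≡ k ℕ.+ k
n+n*n-even zero    = 0 , refl
n+n*n-even (suc n) with n+n*n-even n
... | k , eq = suc (n ℕ.+ k) , trans (expand n) (trans (cong (2 ℕ.+ n ℕ.+ n ℕ.+_) eq) (regroup n k))
  where
  expand : ∀ n → suc n ℕ.+ suc n ℕ.* suc n ≡ 2 ℕ.+ n ℕ.+ n ℕ.+ (n ℕ.+ n ℕ.* n)
  expand = solve-∀
  regroup : ∀ n k → 2 ℕ.+ n ℕ.+ n ℕ.+ (k ℕ.+ k) ≡ suc (n ℕ.+ k) ℕ.+ suc (n ℕ.+ k)
  regroup = solve-∀


-- With integer coefficients the solver's normal forms compute; with the ring's own elements they would not.
module IntegerCoefficients {c ℓ} (R : CommutativeRing c ℓ) where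
  open import Data.Integer as ℤ using (ℤ; +_; -[1+_]; _⊖_)
  import Data.Integer.Properties as ℤ
  open import Data.Maybe using (Maybe; just; nothing)
  open import Algebra.Solver.Ring.AlmostCommutativeRing
    using (AlmostCommutativeRing; fromCommutativeRing; _-Raw-AlmostCommutative⟶_)
  import Algebra.Solver.CommutativeMonoid as CommutativeMonoidSolver

  open CommutativeRing R renaming (refl to ≈-refl; sym to ≈-sym; trans to ≈-trans)
  open import Algebra.Properties.Ring ring
    using (-0#≈0#; -‿involutive; -‿+-comm; -‿distribˡ-*; -‿distribʳ-*)
  open import Algebra.Properties.Semiring.Mult.TCOptimised semiring
    using (1+×; ×-homo-+; ×1-homo-*) renaming (_×_ to _×′_)
  open import Relation.Binary.Reasoning.Setoid setoid

  fromℤ : ℤ → Carrier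
  fromℤ (+ n)    = n ×′ 1#
  fromℤ -[1+ n ] = - (suc n ×′ 1#)

  private
    ⊖-homo : ∀ m n → fromℤ (m ⊖ n) ≈ m ×′ 1# + - (n ×′ 1#)
    ⊖-homo m       zero    = ≈-sym (≈-trans (+-congˡ -0#≈0#) (+-identityʳ _))
    ⊖-homo zero    (suc n) = ≈-sym (+-identityˡ _)
    ⊖-homo (suc m) (suc n) = begin
      fromℤ (suc m ⊖ suc n)               ≡⟨ ≡.cong fromℤ (ℤ.[1+m]⊖[1+n]≡m⊖n m n) ⟩
      fromℤ (m ⊖ n)                       ≈⟨ ⊖-homo m n ⟩
      m ×′ 1# + - (n ×′ 1#)               ≈⟨ cancel-1# (m ×′ 1#) (n ×′ 1#) ⟩
      (1# + m ×′ 1#) + - (1# + n ×′ 1#)   ≈⟨ +-cong (1+× m 1#) (-‿cong (1+× n 1#)) ⟨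
      suc m ×′ 1# + - (suc n ×′ 1#)       ∎
      where
      open CommutativeMonoidSolver +-commutativeMonoid using (solve; _⊕_; _⊜_)
      cancel-1# : ∀ a b → a + - b ≈ (1# + a) + - (1# + b)
      cancel-1# a b = begin
        a + - b                    ≈⟨ +-identityˡ _ ⟨
        0# + (a + - b)             ≈⟨ +-congʳ (-‿inverseʳ 1#) ⟨
        (1# + - 1#) + (a + - b)    ≈⟨ solve 4 (λ o a o′ b → (o ⊕ o′) ⊕ (a ⊕ b) ⊜ (o ⊕ a) ⊕ (o′ ⊕ b))
                                            ≈-refl 1# a (- 1#) (- b) ⟩
        (1# + a) + (- 1# + - b)    ≈⟨ +-congˡ (-‿+-comm 1# b) ⟩
        (1# + a) + - (1# + b)      ∎

    +-homo : ∀ i j → fromℤ (i ℤ.+ j) ≈ fromℤ i + fromℤ j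
    +-homo (+ m)    (+ n)    = ×-homo-+ 1# m n
    +-homo (+ m)    -[1+ n ] = ⊖-homo m (suc n)
    +-homo -[1+ m ] (+ n)    = ≈-trans (⊖-homo n (suc m)) (+-comm _ _)
    +-homo -[1+ m ] -[1+ n ] = begin
      - (suc (suc (m ℕ.+ n)) ×′ 1#)       ≡⟨ ≡.cong (λ k → - (suc k ×′ 1#)) (ℕ.+-suc m n) ⟨
      - ((suc m ℕ.+ suc n) ×′ 1#)         ≈⟨ -‿cong (×-homo-+ 1# (suc m) (suc n)) ⟩
      - (suc m ×′ 1# + suc n ×′ 1#)       ≈⟨ -‿+-comm _ _ ⟨
      - (suc m ×′ 1#) + - (suc n ×′ 1#)   ∎

    -‿homo : ∀ i → fromℤ (ℤ.- i) ≈ - fromℤ i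
    -‿homo (+ zero)  = ≈-sym -0#≈0#
    -‿homo (+ suc n) = ≈-refl
    -‿homo -[1+ n ]  = ≈-sym (-‿involutive _)

    *-homo : ∀ i j → fromℤ (i ℤ.* j) ≈ fromℤ i * fromℤ j
    *-homo (+ zero)  j         = ≈-sym (zeroˡ _)
    *-homo i         (+ zero)  = ≈-trans (reflexive (≡.cong fromℤ (ℤ.*-zeroʳ i))) (≈-sym (zeroʳ _))
    *-homo (+ suc m) (+ suc n) = ×1-homo-* (suc m) (suc n)
    *-homo (+ suc m) -[1+ n ]  = ≈-trans (-‿cong (×1-homo-* (suc m) (suc n))) (-‿distribʳ-* _ _)
    *-homo -[1+ m ]  (+ suc n) = ≈-trans (-‿cong (×1-homo-* (suc m) (suc n))) (-‿distribˡ-* _ _)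
    *-homo -[1+ m ]  -[1+ n ]  = begin
      (suc m ℕ.* suc n) ×′ 1#   ≈⟨ ×1-homo-* (suc m) (suc n) ⟩
      a * b                     ≈⟨ -‿involutive _ ⟨
      - - (a * b)               ≈⟨ -‿cong (-‿distribˡ-* a b) ⟩
      - (- a * b)               ≈⟨ -‿distribʳ-* (- a) b ⟩
      - a * - b                 ∎
      where
      a = suc m ×′ 1#
      b = suc n ×′ 1#

    almostCommutativeRing : AlmostCommutativeRing c ℓ
    almostCommutativeRing = fromCommutativeRing R

    fromℤ-homomorphism : ℤ.+-*-rawRing -Raw-AlmostCommutative⟶ almostCommutativeRing
    fromℤ-homomorphism = record
      { ⟦_⟧ = fromℤ ; +-homo = +-homo ; *-homo = *-homo ; -‿homo = -‿homo
      ; 0-homo = ≈-refl ; 1-homo = ≈-refl }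

    fromℤ-≟ : ∀ i j → Maybe (fromℤ i ≈ fromℤ j)
    fromℤ-≟ i j with i ℤ.≟ j
    ... | yes ≡.refl = just ≈-refl
    ... | no _       = nothing

  open import Algebra.Solver.Ring ℤ.+-*-rawRing almostCommutativeRing fromℤ-homomorphism fromℤ-≟
    public


module ListCounting {A : Set} where
  open import Data.Nat.ListAction using (sum)
  open import Data.List.Properties using (filter-notAll)
  open import Algebra.Properties.CommutativeSemigroup ℕ.+-commutativeSemigroup using (interchange)
  open import Data.List.Membership.Propositional.Properties using (∈-filter⁺)
  open import Relation.Binary.Definitions using (DecidableEquality)
  open import Data.List.Relation.Binary.Permutation.Propositional using (_↭_)
  open import Data.List.Relation.Binary.BagAndSetEquality using (∼bag⇒↭)
  open import Data.List.Membership.Propositional.Properties.WithK using (unique∧set⇒bag)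
  open import Function.Bundles using (mk⇔)

  unique-⊆⇒length-≤ : DecidableEquality A → ∀ {xs ys : List A} →
    Unique xs → (∀ {x} → x ∈ xs → x ∈ ys) → length xs ≤ length ys
  unique-⊆⇒length-≤ _≟_ {[]}     _               _     = z≤n
  unique-⊆⇒length-≤ _≟_ {x ∷ xs} {ys} (x∉xs ∷ xs!) xs⊆ys =
    ℕ.<-≤-trans (s≤s (unique-⊆⇒length-≤ _≟_ xs! xs⊆ys∖x))
      (filter-notAll ≢x? ys (Any.map (λ x≡y x≢y → x≢y x≡y) (xs⊆ys (here refl))))
    where
    ≢x? : Decidable (x ≢_)
    ≢x? y = ¬? (x ≟ y)
    xs⊆ys∖x : ∀ {z} → z ∈ xs → z ∈ filter ≢x? ys
    xs⊆ys∖x z∈xs = ∈-filter⁺ ≢x? (xs⊆ys (there z∈xs)) (All.lookup x∉xs z∈xs)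

  unique-⊆-⊇⇒↭ : ∀ {xs ys : List A} → Unique xs → Unique ys →
    (∀ {z} → z ∈ xs → z ∈ ys) → (∀ {z} → z ∈ ys → z ∈ xs) → xs ↭ ys
  unique-⊆-⊇⇒↭ xs! ys! xs⊆ys ys⊆xs = ∼bag⇒↭ (unique∧set⇒bag xs! ys! (mk⇔ xs⊆ys ys⊆xs))

  ∑ : List A → (A → ℕ) → ℕ
  ∑ xs g = sum (map g xs)

  dec⇒ℕ : ∀ {B : Set} → Dec B → ℕ
  dec⇒ℕ (yes _) = 1
  dec⇒ℕ (no  _) = 0

  indicator : ∀ {P : Pred A 0ℓ} → Decidable P → A → ℕ
  indicator P? x = dec⇒ℕ (P? x)

  indicator-yes : ∀ {P : Pred A 0ℓ} (P? : Decidable P) {x} → P x → indicator P? x ≡ 1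
  indicator-yes P? {x} Px with P? x
  ... | yes _  = refl
  ... | no ¬Px = ⊥-elim (¬Px Px)

  indicator-no : ∀ {P : Pred A 0ℓ} (P? : Decidable P) {x} → ¬ P x → indicator P? x ≡ 0
  indicator-no P? {x} ¬Px with P? x
  ... | yes Px = ⊥-elim (¬Px Px)
  ... | no _   = refl

  length≡∑-1 : ∀ xs → length xs ≡ ∑ xs (λ _ → 1)
  length≡∑-1 []       = refl
  length≡∑-1 (x ∷ xs) = cong suc (length≡∑-1 xs)

  length-filter≡∑-indicator : ∀ {P : Pred A 0ℓ} (P? : Decidable P) xs →
    length (filter P? xs) ≡ ∑ xs (indicator P?)
  length-filter≡∑-indicator P? []       = refl
  length-filter≡∑-indicator P? (x ∷ xs) with P? x
  ... | yes _ = cong suc (length-filter≡∑-indicator P? xs)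
  ... | no  _ = length-filter≡∑-indicator P? xs

  ∑-cong : ∀ xs {g h : A → ℕ} → (∀ x → g x ≡ h x) → ∑ xs g ≡ ∑ xs h
  ∑-cong []       g≗h = refl
  ∑-cong (x ∷ xs) g≗h = cong₂ ℕ._+_ (g≗h x) (∑-cong xs g≗h)

  ∑-mono : ∀ xs {g h : A → ℕ} → (∀ x → g x ≤ h x) → ∑ xs g ≤ ∑ xs h
  ∑-mono []       g≤h = z≤n
  ∑-mono (x ∷ xs) g≤h = ℕ.+-mono-≤ (g≤h x) (∑-mono xs g≤h)

  ∑-0 : ∀ xs → ∑ xs (λ _ → 0) ≡ 0
  ∑-0 []       = refl
  ∑-0 (x ∷ xs) = ∑-0 xs

  ∑-+ : ∀ xs (g h : A → ℕ) → ∑ xs (λ x → g x ℕ.+ h x) ≡ ∑ xs g ℕ.+ ∑ xs h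
  ∑-+ []       g h = refl
  ∑-+ (x ∷ xs) g h = trans (cong (g x ℕ.+ h x ℕ.+_) (∑-+ xs g h))
    (interchange (g x) (h x) (∑ xs g) (∑ xs h))

  ∑-swap : ∀ xs ys (g : A → A → ℕ) → ∑ xs (λ x → ∑ ys (g x)) ≡ ∑ ys (λ y → ∑ xs (λ x → g x y))
  ∑-swap []       ys g = sym (∑-0 ys)
  ∑-swap (x ∷ xs) ys g = trans (cong (∑ ys (g x) ℕ.+_) (∑-swap xs ys g))
    (sym (∑-+ ys (g x) (λ y → ∑ xs (λ x′ → g x′ y))))

  ∑-tight : ∀ xs {g h : A → ℕ} → (∀ x → h x ≤ g x) → ∑ xs g ≤ ∑ xs h → ∀ {x} → x ∈ xs → g x ≤ h x
  ∑-tight (y ∷ xs) {g} {h} h≤g ∑g≤∑h (here refl) =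
    ℕ.+-cancelʳ-≤ _ _ _ (ℕ.≤-trans ∑g≤∑h (ℕ.+-monoʳ-≤ (h y) (∑-mono xs h≤g)))
  ∑-tight (y ∷ xs) {g} {h} h≤g ∑g≤∑h (there x∈xs) =
    ∑-tight xs h≤g (ℕ.+-cancelˡ-≤ (h y) _ _ (ℕ.≤-trans (ℕ.+-monoˡ-≤ _ (h≤g y)) ∑g≤∑h)) x∈xs


module FieldArithmetic (K : FiniteField) where
  open FiniteField K public

  commutativeRing : CommutativeRing 0ℓ 0ℓ
  commutativeRing = record { isCommutativeRing = isCommutativeRing }

  open CommutativeRing commutativeRing public
    using ( +-identityˡ; -‿inverseʳ; *-assoc; *-comm; *-identityˡ; *-identityʳ; zeroˡ; zeroʳ
          ; commutativeSemiring; *-isCommutativeMonoid)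
  open IntegerCoefficients commutativeRing public
    using (solve; _:+_; _:*_; :-_; _:-_; _:=_; con)

  open import Algebra.Properties.CommutativeSemiring.Exp commutativeSemiring
    using (^-homo-*; ^-assocʳ; ^-distrib-*) renaming (_^_ to _^′_)

  ^≡^′ : ∀ x n → x ^ n ≡ x ^′ n
  ^≡^′ x zero    = refl
  ^≡^′ x (suc n) = cong (x *_) (^≡^′ x n)

  ^-+ : ∀ x m n → x ^ (m ℕ.+ n) ≡ x ^ m * x ^ n
  ^-+ x m n =
    trans (^≡^′ x (m ℕ.+ n)) (trans (^-homo-* x m n) (sym (cong₂ _*_ (^≡^′ x m) (^≡^′ x n))))

  ^-* : ∀ x m n → x ^ (m ℕ.* n) ≡ (x ^ m) ^ n
  ^-* x m n = trans (^≡^′ x (m ℕ.* n))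
    (sym (trans (^≡^′ (x ^ m) n) (trans (cong (_^′ n) (^≡^′ x m)) (^-assocʳ x m n))))

  *-^ : ∀ x y n → (x * y) ^ n ≡ x ^ n * y ^ n
  *-^ x y n =
    trans (^≡^′ (x * y) n) (trans (^-distrib-* x y n) (sym (cong₂ _*_ (^≡^′ x n) (^≡^′ y n))))

  ^-comm : ∀ x m n → (x ^ m) ^ n ≡ (x ^ n) ^ m
  ^-comm x m n = trans (sym (^-* x m n)) (trans (cong (x ^_) (ℕ.*-comm m n)) (^-* x n m))

  1^ : ∀ n → 1# ^ n ≡ 1#
  1^ zero    = refl
  1^ (suc n) = trans (*-identityˡ _) (1^ n)

  1≢0 : 1# ≢ 0#
  1≢0 = 0≢1 ∘ sym

  ≢0? : Decidable (_≢ 0#)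
  ≢0? x = ¬? (x ≟ 0#)

  -- Junk value: 0# ⁻¹ ≡ 0#.
  _⁻¹ : F → F
  x ⁻¹ with x ≟ 0#
  ... | yes _   = 0#
  ... | no  x≢0 = proj₁ (inv x x≢0)

  x*x⁻¹≡1 : ∀ {x} → x ≢ 0# → x * x ⁻¹ ≡ 1#
  x*x⁻¹≡1 {x} x≢0 with x ≟ 0#
  ... | yes x≡0  = ⊥-elim (x≢0 x≡0)
  ... | no  x≢0′ = proj₂ (inv x x≢0′)

  x⁻¹*[x*y]≡y : ∀ {x} y → x ≢ 0# → x ⁻¹ * (x * y) ≡ y
  x⁻¹*[x*y]≡y {x} y x≢0 = begin
    x ⁻¹ * (x * y)   ≡⟨ solve 3 (λ x u y → u :* (x :* y) := (x :* u) :* y) refl x (x ⁻¹) y ⟩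
    (x * x ⁻¹) * y   ≡⟨ cong (_* y) (x*x⁻¹≡1 x≢0) ⟩
    1# * y           ≡⟨ *-identityˡ y ⟩
    y                ∎
    where open ≡-Reasoning

  x*y*y⁻¹≡x : ∀ x {y} → y ≢ 0# → x * y * y ⁻¹ ≡ x
  x*y*y⁻¹≡x x y≢0 = trans (*-assoc x _ _) (trans (cong (x *_) (x*x⁻¹≡1 y≢0)) (*-identityʳ x))

  x*y⁻¹*y≡x : ∀ x {y} → y ≢ 0# → x * y ⁻¹ * y ≡ x
  x*y⁻¹*y≡x x y≢0 = trans (*-assoc x _ _) (trans (cong (x *_) (trans (*-comm _ _) (x*x⁻¹≡1 y≢0))) (*-identityʳ x))

  *-cancelˡ : ∀ {x y z} → x ≢ 0# → x * y ≡ x * z → y ≡ z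
  *-cancelˡ {x} {y} {z} x≢0 xy≡xz =
    trans (sym (x⁻¹*[x*y]≡y y x≢0)) (trans (cong (x ⁻¹ *_) xy≡xz) (x⁻¹*[x*y]≡y z x≢0))

  *-cancelʳ : ∀ {x y z} → x ≢ 0# → y * x ≡ z * x → y ≡ z
  *-cancelʳ {x} {y} {z} x≢0 yx≡zx = *-cancelˡ x≢0 (trans (*-comm x y) (trans yx≡zx (*-comm z x)))

  x*y≡0⇒x≡0⊎y≡0 : ∀ {x y} → x * y ≡ 0# → x ≡ 0# ⊎ y ≡ 0#
  x*y≡0⇒x≡0⊎y≡0 {x} {y} xy≡0 with x ≟ 0#
  ... | yes x≡0 = inj₁ x≡0
  ... | no  x≢0 = inj₂ (*-cancelˡ x≢0 (trans xy≡0 (sym (zeroʳ x))))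

  *-≢0 : ∀ {x y} → x ≢ 0# → y ≢ 0# → x * y ≢ 0#
  *-≢0 x≢0 y≢0 xy≡0 with x*y≡0⇒x≡0⊎y≡0 xy≡0
  ... | inj₁ x≡0 = x≢0 x≡0
  ... | inj₂ y≡0 = y≢0 y≡0

  ^-≢0 : ∀ {x} n → x ≢ 0# → x ^ n ≢ 0#
  ^-≢0 zero    x≢0 = 1≢0
  ^-≢0 (suc n) x≢0 = *-≢0 x≢0 (^-≢0 n x≢0)

  ⁻¹-unique : ∀ {x y} → x * y ≡ 1# → y ≡ x ⁻¹
  ⁻¹-unique {x} {y} xy≡1 = *-cancelˡ x≢0 (trans xy≡1 (sym (x*x⁻¹≡1 x≢0)))
    where
    x≢0 : x ≢ 0#
    x≢0 x≡0 = 0≢1 (trans (sym (zeroˡ y)) (trans (cong (_* y) (sym x≡0)) xy≡1))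

  ⁻¹-≢0 : ∀ {x} → x ≢ 0# → x ⁻¹ ≢ 0#
  ⁻¹-≢0 {x} x≢0 x⁻¹≡0 = 1≢0 (trans (sym (x*x⁻¹≡1 x≢0)) (trans (cong (x *_) x⁻¹≡0) (zeroʳ x)))

  ⁻¹-* : ∀ {x y} → x ≢ 0# → y ≢ 0# → (x * y) ⁻¹ ≡ x ⁻¹ * y ⁻¹
  ⁻¹-* {x} {y} x≢0 y≢0 = sym (⁻¹-unique (begin
    (x * y) * (x ⁻¹ * y ⁻¹)     ≡⟨ solve 4 (λ x y u v → (x :* y) :* (u :* v) := (x :* u) :* (y :* v))
                                         refl x y (x ⁻¹) (y ⁻¹) ⟩
    (x * x ⁻¹) * (y * y ⁻¹)     ≡⟨ cong₂ _*_ (x*x⁻¹≡1 x≢0) (x*x⁻¹≡1 y≢0) ⟩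
    1# * 1#                     ≡⟨ *-identityʳ 1# ⟩
    1#                          ∎))
    where open ≡-Reasoning

  ⁻¹-^ : ∀ {x} n → x ≢ 0# → (x ⁻¹) ^ n ≡ (x ^ n) ⁻¹
  ⁻¹-^ {x} n x≢0 = ⁻¹-unique (begin
    x ^ n * (x ⁻¹) ^ n   ≡⟨ sym (*-^ x (x ⁻¹) n) ⟩
    (x * x ⁻¹) ^ n       ≡⟨ cong (_^ n) (x*x⁻¹≡1 x≢0) ⟩
    1# ^ n               ≡⟨ 1^ n ⟩
    1#                   ∎)
    where open ≡-Reasoning

  -1^[k+k] : ∀ k → (- 1#) ^ (k ℕ.+ k) ≡ 1#
  -1^[k+k] k = begin
    (- 1#) ^ (k ℕ.+ k)           ≡⟨ ^-+ (- 1#) k k ⟩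
    (- 1#) ^ k * (- 1#) ^ k      ≡⟨ *-^ (- 1#) (- 1#) k ⟨
    (- 1# * - 1#) ^ k            ≡⟨ cong (_^ k) (solve 0 (:- con (+ 1) :* :- con (+ 1) := con (+ 1)) refl) ⟩
    1# ^ k                       ≡⟨ 1^ k ⟩
    1#                           ∎
    where open ≡-Reasoning


module Counting (K : FiniteField) where
  open FieldArithmetic K
  open ListCounting
  open import Data.List.Properties using (length-map)
  open import Data.List.Membership.Propositional.Properties using (∈-filter⁺; ∈-filter⁻; ∈-map⁻)

  count : {P : Pred F 0ℓ} → Decidable P → ℕ
  count P? = length (filter P? elems)

  module _ {P Q : Pred F 0ℓ} (P? : Decidable P) (Q? : Decidable Q) where

    count-≤-injection : (φ : F → F) → (∀ {x y} → φ x ≡ φ y → x ≡ y) →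
      (∀ {x} → P x → Q (φ x)) → count P? ≤ count Q?
    count-≤-injection φ φ-injective P⇒Qφ = begin
      count P?                        ≡⟨ sym (length-map φ (filter P? elems)) ⟩
      length (map φ (filter P? elems)) ≤⟨ unique-⊆⇒length-≤ _≟_
                                           (Unique.map⁺ φ-injective (Unique.filter⁺ P? {elems} unique)) image⊆Q ⟩
      count Q?                        ∎
      where
      open ℕ.≤-Reasoning
      image⊆Q : ∀ {y} → y ∈ map φ (filter P? elems) → y ∈ filter Q? elems
      image⊆Q y∈ with ∈-map⁻ φ y∈
      ... | x , x∈ , refl = ∈-filter⁺ Q? (complete (φ x)) (P⇒Qφ (proj₂ (∈-filter⁻ P? {xs = elems} x∈)))

    count-mono : (∀ {x} → P x → Q x) → count P? ≤ count Q?
    count-mono = count-≤-injection (λ x → x) (λ eq → eq)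

    count-mono-tight : (∀ {x} → P x → Q x) → count Q? ≤ count P? → ∀ {x} → Q x → P x
    count-mono-tight P⊆Q count-Q≤count-P {x} Qx with P? x
    ... | yes Px = Px
    ... | no ¬Px = ⊥-elim (ℕ.<-irrefl refl (ℕ.<-≤-trans more count-Q≤count-P))
      where
      more : suc (count P?) ≤ count Q?
      more = unique-⊆⇒length-≤ _≟_
        (All.tabulate (λ y∈ x≡y → ¬Px (subst P (sym x≡y) (proj₂ (∈-filter⁻ P? {xs = elems} y∈))))
          ∷ Unique.filter⁺ P? {elems} unique)
        λ { (here refl) → ∈-filter⁺ Q? (complete x) Qx
          ; (there y∈)  → ∈-filter⁺ Q? (complete _) (P⊆Q (proj₂ (∈-filter⁻ P? {xs = elems} y∈))) }

  card≤count+count : {P Q : Pred F 0ℓ} (P? : Decidable P) (Q? : Decidable Q) →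
    (∀ x → P x ⊎ Q x) → card ≤ count P? ℕ.+ count Q?
  card≤count+count P? Q? P∪Q = begin
    card                                                ≡⟨ length≡∑-1 elems ⟩
    ∑ elems (λ _ → 1)                                   ≤⟨ ∑-mono elems pointwise ⟩
    ∑ elems (λ x → indicator P? x ℕ.+ indicator Q? x)    ≡⟨ ∑-+ elems (indicator P?) (indicator Q?) ⟩
    ∑ elems (indicator P?) ℕ.+ ∑ elems (indicator Q?)   ≡⟨ sym (cong₂ ℕ._+_ (length-filter≡∑-indicator P? elems)
                                                                            (length-filter≡∑-indicator Q? elems)) ⟩
    count P? ℕ.+ count Q?                               ∎
    where
    open ℕ.≤-Reasoning
    pointwise : ∀ x → 1 ≤ indicator P? x ℕ.+ indicator Q? x
    pointwise x with P∪Q x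
    ... | inj₁ Px = subst (λ n → 1 ≤ n ℕ.+ indicator Q? x) (sym (indicator-yes P? Px)) (s≤s z≤n)
    ... | inj₂ Qx = subst (λ n → 1 ≤ indicator P? x ℕ.+ n) (sym (indicator-yes Q? Qx)) (ℕ.m≤n+m 1 _)

  ∃? : {P : Pred F 0ℓ} → Decidable P → Dec (Σ F P)
  ∃? P? with Any.any? P? elems
  ... | yes some = yes (Any.satisfied some)
  ... | no none  = no λ (x , Px) → none (Any.map (λ { refl → Px }) (complete x))


module Fermat (K : FiniteField) where
  open FieldArithmetic K
  open ListCounting using (unique-⊆-⊇⇒↭)
  open import Data.List.Relation.Binary.Permutation.Propositional using (_↭_; ↭⇒↭ₛ)
  open import Data.List.Relation.Binary.Permutation.Propositional.Properties using (↭-length)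
  open import Data.List.Relation.Binary.Permutation.Setoid.Properties using (foldr-commMonoid)
  open import Data.List.Membership.Propositional.Properties using (∈-filter⁺; ∈-filter⁻; ∈-map⁺; ∈-map⁻)

  ∏ : List F → F
  ∏ = foldr _*_ 1#

  ∏-↭ : ∀ {xs ys} → xs ↭ ys → ∏ xs ≡ ∏ ys
  ∏-↭ xs↭ys = foldr-commMonoid (≡.setoid F) *-isCommutativeMonoid (↭⇒↭ₛ xs↭ys)

  ∏-map-* : ∀ y xs → ∏ (map (y *_) xs) ≡ y ^ length xs * ∏ xs
  ∏-map-* y []       = sym (*-identityʳ 1#)
  ∏-map-* y (x ∷ xs) = trans (cong (y * x *_) (∏-map-* y xs))
    (solve 4 (λ y x a p → (y :* x) :* (a :* p) := (y :* a) :* (x :* p)) refl y x (y ^ length xs) (∏ xs))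

  ∏-≢0 : ∀ {xs} → All (_≢ 0#) xs → ∏ xs ≢ 0#
  ∏-≢0 []            = 1≢0
  ∏-≢0 (x≢0 ∷ xs≢0) = *-≢0 x≢0 (∏-≢0 xs≢0)

  units : List F
  units = filter ≢0? elems

  units! : Unique units
  units! = Unique.filter⁺ ≢0? {elems} unique

  units-≢0 : ∀ {x} → x ∈ units → x ≢ 0#
  units-≢0 x∈ = proj₂ (∈-filter⁻ ≢0? {xs = elems} x∈)

  ∈-units : ∀ {x} → x ≢ 0# → x ∈ units
  ∈-units x≢0 = ∈-filter⁺ ≢0? (complete _) x≢0

  card≡1+length-units : card ≡ suc (length units)
  card≡1+length-units = ↭-length (unique-⊆-⊇⇒↭ unique 0∷units! (λ {z} _ → ∈-0∷units z) (λ {z} _ → complete z))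
    where
    0∷units! : Unique (0# ∷ units)
    0∷units! = All.tabulate (λ z∈ 0≡z → units-≢0 z∈ (sym 0≡z)) ∷ units!
    ∈-0∷units : ∀ z → z ∈ 0# ∷ units
    ∈-0∷units z with z ≟ 0#
    ... | yes z≡0 = here z≡0
    ... | no  z≢0 = there (∈-units z≢0)

  -- Multiplication by a unit permutes the units; compare the products.
  ^-length-units : ∀ {y} → y ≢ 0# → y ^ length units ≡ 1#
  ^-length-units {y} y≢0 = *-cancelʳ (∏-≢0 (All.tabulate units-≢0)) (begin
    y ^ length units * ∏ units   ≡⟨ sym (∏-map-* y units) ⟩
    ∏ (map (y *_) units)          ≡⟨ ∏-↭ (unique-⊆-⊇⇒↭ (Unique.map⁺ (*-cancelˡ y≢0) units!) units!
                                                          ⊆units units⊆) ⟩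
    ∏ units                       ≡⟨ sym (*-identityˡ _) ⟩
    1# * ∏ units                  ∎)
    where
    open ≡-Reasoning
    ⊆units : ∀ {z} → z ∈ map (y *_) units → z ∈ units
    ⊆units z∈ with ∈-map⁻ (y *_) z∈
    ... | x , x∈ , refl = ∈-units (*-≢0 y≢0 (units-≢0 x∈))
    units⊆ : ∀ {z} → z ∈ units → z ∈ map (y *_) units
    units⊆ {z} z∈ = subst (_∈ map (y *_) units) (trans (*-comm y _) (x*y⁻¹*y≡x z y≢0))
      (∈-map⁺ (y *_) (∈-units (*-≢0 (units-≢0 z∈) (⁻¹-≢0 y≢0))))

  fermat : ∀ y → y ^ card ≡ y
  fermat y rewrite card≡1+length-units with y ≟ 0#
  ... | yes refl = zeroˡ _
  ... | no  y≢0  = trans (cong (y *_) (^-length-units y≢0)) (*-identityʳ y)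


module MonicPolynomials (K : FiniteField) where
  open FieldArithmetic K
  open Counting K using (count)
  open import Data.List.Relation.Unary.All.Properties using (all-filter)

  -- Monic d g: g agrees pointwise with a monic polynomial of degree d, given in Horner form.
  data Monic : ℕ → (F → F) → Set where
    one    : ∀ {g} → (∀ y → g y ≡ 1#) → Monic 0 g
    horner : ∀ {d g h} (c : F) → Monic d h → (∀ y → g y ≡ c + y * h y) → Monic (suc d) g

  monic-resp : ∀ {d g g′} → Monic d g → (∀ y → g′ y ≡ g y) → Monic d g′
  monic-resp (one g≡1)          g′≗g = one (λ y → trans (g′≗g y) (g≡1 y))
  monic-resp (horner c h-monic g≡) g′≗g = horner c h-monic (λ y → trans (g′≗g y) (g≡ y))

  monic-+-lower : ∀ {d h k} → Monic (suc d) h → Monic d k → ∀ a → Monic (suc d) (λ y → h y + a * k y)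
  monic-+-lower {zero} {h} {k} (horner {h = h′} c h′-monic h≡) (one k≡1) a =
    horner (c + a) h′-monic λ y → begin
      h y + a * k y     ≡⟨ cong₂ _+_ (h≡ y) (trans (cong (a *_) (k≡1 y)) (*-identityʳ a)) ⟩
      c + y * h′ y + a  ≡⟨ solve 4 (λ c a y h → c :+ y :* h :+ a := c :+ a :+ y :* h) refl c a y (h′ y) ⟩
      c + a + y * h′ y  ∎
    where open ≡-Reasoning
  monic-+-lower {suc d} {h} {k} (horner {h = h′} c h′-monic h≡) (horner {h = k′} c′ k′-monic k≡) a =
    horner (c + a * c′) (monic-+-lower h′-monic k′-monic a) λ y → begin
      h y + a * k y                       ≡⟨ cong₂ (λ u v → u + a * v) (h≡ y) (k≡ y) ⟩
      c + y * h′ y + a * (c′ + y * k′ y)  ≡⟨ solve 6 (λ c a c′ y h k → c :+ y :* h :+ a :* (c′ :+ y :* k)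
                                                 := c :+ a :* c′ :+ y :* (h :+ a :* k)) refl c a c′ y (h′ y) (k′ y) ⟩
      c + a * c′ + y * (h′ y + a * k′ y)  ∎
    where open ≡-Reasoning

  horner-difference : ∀ c y u a v → (c + y * u) + - (c + a * v) ≡ (y + - a) * u + a * (u + - v)
  horner-difference = solve 5 (λ c y u a v → (c :+ y :* u) :- (c :+ a :* v) := (y :- a) :* u :+ a :* (u :- v)) refl

  factor-theorem : ∀ {d g} → Monic (suc d) g → ∀ a →
    Σ (F → F) λ q → Monic d q × (∀ y → g y + - g a ≡ (y + - a) * q y)
  factor-theorem {zero} {g} (horner {h = h} c (one h≡1) g≡) a = h , one h≡1 , λ y → begin
    g y + - g a                          ≡⟨ cong₂ (λ u v → u + - v) (g≡ y) (g≡ a) ⟩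
    (c + y * h y) + - (c + a * h a)      ≡⟨ horner-difference c y (h y) a (h a) ⟩
    (y + - a) * h y + a * (h y + - h a)  ≡⟨ cong (λ u → (y + - a) * h y + a * (u + - h a)) (trans (h≡1 y) (sym (h≡1 a))) ⟩
    (y + - a) * h y + a * (h a + - h a)  ≡⟨ solve 4 (λ y a u v → (y :- a) :* u :+ a :* (v :- v) := (y :- a) :* u)
                                                   refl y a (h y) (h a) ⟩
    (y + - a) * h y                      ∎
    where open ≡-Reasoning
  factor-theorem {suc d} {g} (horner {h = h} c h-monic g≡) a with factor-theorem h-monic a
  ... | q , q-monic , h-factored = (λ y → h y + a * q y) , monic-+-lower h-monic q-monic a , λ y → begin
    g y + - g a                          ≡⟨ cong₂ (λ u v → u + - v) (g≡ y) (g≡ a) ⟩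
    (c + y * h y) + - (c + a * h a)      ≡⟨ horner-difference c y (h y) a (h a) ⟩
    (y + - a) * h y + a * (h y + - h a)  ≡⟨ cong (λ u → (y + - a) * h y + a * u) (h-factored y) ⟩
    (y + - a) * h y + a * ((y + - a) * q y)  ≡⟨ solve 4 (λ y a u v → (y :- a) :* u :+ a :* ((y :- a) :* v)
                                                   := (y :- a) :* (u :+ a :* v)) refl y a (h y) (q y) ⟩
    (y + - a) * (h y + a * q y)          ∎
    where open ≡-Reasoning

  roots≤degree : ∀ {d g xs} → Monic d g → Unique xs → All (λ x → g x ≡ 0#) xs → length xs ≤ d
  roots≤degree _ [] [] = z≤n
  roots≤degree (one g≡1) (_ ∷ _) (ga≡0 ∷ _) = ⊥-elim (1≢0 (trans (sym (g≡1 _)) ga≡0))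
  roots≤degree {g = g} {xs = a ∷ xs} g-monic@(horner _ _ _) (a∉xs ∷ xs!) (ga≡0 ∷ gxs≡0)
    with factor-theorem g-monic a
  ... | q , q-monic , g-factored = s≤s (roots≤degree q-monic xs! (All.zipWith q-root (a∉xs , gxs≡0)))
    where
    q-root : ∀ {x} → a ≢ x × g x ≡ 0# → q x ≡ 0#
    q-root {x} (a≢x , gx≡0) with x*y≡0⇒x≡0⊎y≡0 (trans (sym (g-factored x)) g[x]-g[a]≡0)
      where
      g[x]-g[a]≡0 : g x + - g a ≡ 0#
      g[x]-g[a]≡0 = trans (cong₂ (λ u v → u + - v) gx≡0 ga≡0) (-‿inverseʳ 0#)
    ... | inj₂ qx≡0   = qx≡0
    ... | inj₁ x-a≡0 = ⊥-elim (a≢x (sym (begin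
      x                ≡⟨ solve 2 (λ x a → x := (x :- a) :+ a) refl x a ⟩
      (x + - a) + a    ≡⟨ cong (_+ a) x-a≡0 ⟩
      0# + a           ≡⟨ +-identityˡ a ⟩
      a                ∎)))
      where open ≡-Reasoning

  count-roots≤degree : ∀ {d g} → Monic d g → count (λ y → g y ≟ 0#) ≤ d
  count-roots≤degree {g = g} g-monic =
    roots≤degree g-monic (Unique.filter⁺ (λ y → g y ≟ 0#) {elems} unique) (all-filter (λ y → g y ≟ 0#) elems)

  monic-1 : Monic 0 (λ _ → 1#)
  monic-1 = one (λ _ → refl)

  monic-X* : ∀ {d h} → Monic d h → Monic (suc d) (λ y → y * h y)
  monic-X* h-monic = horner 0# h-monic (λ y → sym (+-identityˡ _))

  monic-X^* : ∀ {d h} → Monic d h → ∀ e → Monic (e ℕ.+ d) (λ y → y ^ e * h y)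
  monic-X^* h-monic zero    = monic-resp h-monic (λ y → *-identityˡ _)
  monic-X^* h-monic (suc e) = monic-resp (monic-X* (monic-X^* h-monic e)) (λ y → *-assoc _ _ _)

  monic-+-const : ∀ {d g} → Monic (suc d) g → ∀ c → Monic (suc d) (λ y → g y + c)
  monic-+-const (horner {h = h} c₀ h-monic g≡) c = horner (c₀ + c) h-monic λ y →
    trans (cong (_+ c) (g≡ y)) (solve 4 (λ c₀ y h c → c₀ :+ y :* h :+ c := c₀ :+ c :+ y :* h) refl c₀ y (h y) c)


module Subfields (K : FiniteField) where
  open FieldArithmetic K
  open Counting K
  open Fermat K using (fermat)
  open MonicPolynomials K
  open import Data.Nat.GCD using (gcd-GCD; module Bézout; GCD)


  InSubfield? : ∀ Q → Decidable (InSubfield Q)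
  InSubfield? Q y = (y ^ Q) ≟ y

  0∈subfield : ∀ {q} → 0 < q → InSubfield q 0#
  0∈subfield {suc q} _ = zeroˡ _

  module _ {q : ℕ} where

    subfield-+ : ∀ {a b w} → InSubfield (q ℕ.^ a) w → InSubfield (q ℕ.^ b) w → InSubfield (q ℕ.^ (a ℕ.+ b)) w
    subfield-+ {a} {b} {w} w∈a w∈b =
      trans (cong (w ^_) (ℕ.^-distribˡ-+-* q a b))
        (trans (^-* w (q ℕ.^ a) (q ℕ.^ b)) (trans (cong (_^ (q ℕ.^ b)) w∈a) w∈b))

    subfield-∸ : ∀ {a b w} → InSubfield (q ℕ.^ b) w → InSubfield (q ℕ.^ (a ℕ.+ b)) w → InSubfield (q ℕ.^ a) w
    subfield-∸ {a} {b} {w} w∈b w∈a+b = begin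
      w ^ (q ℕ.^ a)                  ≡⟨ cong (_^ (q ℕ.^ a)) w∈b ⟨
      (w ^ (q ℕ.^ b)) ^ (q ℕ.^ a)    ≡⟨ ^-comm w (q ℕ.^ b) (q ℕ.^ a) ⟩
      (w ^ (q ℕ.^ a)) ^ (q ℕ.^ b)    ≡⟨ ^-* w (q ℕ.^ a) (q ℕ.^ b) ⟨
      w ^ (q ℕ.^ a ℕ.* q ℕ.^ b)      ≡⟨ cong (w ^_) (ℕ.^-distribˡ-+-* q a b) ⟨
      w ^ (q ℕ.^ (a ℕ.+ b))          ≡⟨ w∈a+b ⟩
      w                              ∎
      where open ≡-Reasoning

    subfield-* : ∀ {a w} k → InSubfield (q ℕ.^ a) w → InSubfield (q ℕ.^ (k ℕ.* a)) w
    subfield-* zero        w∈a = *-identityʳ _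
    subfield-* {a} (suc k) w∈a = subfield-+ {a} {k ℕ.* a} w∈a (subfield-* k w∈a)

    -- Bézout: some multiple of one of i, t exceeds a multiple of the other by gcd i t = 1.
    subfield-∩ : ∀ {i t w} → gcd i t ≡ 1 →
      InSubfield (q ℕ.^ i) w → InSubfield (q ℕ.^ t) w → InSubfield q w
    subfield-∩ {i} {t} {w} gcd≡1 w∈i w∈t = subst (λ e → InSubfield e w) (ℕ.*-identityʳ q) w∈1
      where
      resp : ∀ {e e′} → e ≡ e′ → InSubfield (q ℕ.^ e) w → InSubfield (q ℕ.^ e′) w
      resp = subst (λ e → InSubfield (q ℕ.^ e) w)
      w∈1 : InSubfield (q ℕ.^ 1) w
      w∈1 with Bézout.identity (subst (GCD i t) gcd≡1 (gcd-GCD i t))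
      ... | Bézout.+- x y eq = subfield-∸ {1} {y ℕ.* t} (subfield-* y w∈t) (resp (sym eq) (subfield-* x w∈i))
      ... | Bézout.-+ x y eq = subfield-∸ {1} {x ℕ.* i} (subfield-* x w∈i) (resp (sym eq) (subfield-* y w∈t))

    subfield-⊆ : ∀ {w} → InSubfield q w → ∀ e → InSubfield (q ℕ.^ e) w
    subfield-⊆ {w} w∈q zero    = *-identityʳ w
    subfield-⊆ {w} w∈q (suc e) =
      trans (^-* w q (q ℕ.^ e)) (trans (cong (_^ (q ℕ.^ e)) w∈q) (subfield-⊆ w∈q e))

  module X^q-X (d′ : ℕ) where

    d q : ℕ
    d = suc d′
    q = suc d

    x^q-x : F → F
    x^q-x y = y * (y ^ d + - 1#)

    roots? : Decidable (λ y → x^q-x y ≡ 0#)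
    roots? y = x^q-x y ≟ 0#

    x^q-x-monic : Monic q x^q-x
    x^q-x-monic = monic-X* (monic-+-const
      (subst (λ e → Monic e (_^ d)) (ℕ.+-identityʳ d) (monic-resp (monic-X^* monic-1 d) (λ y → sym (*-identityʳ _))))
      (- 1#))

    x^q-x-root : ∀ y → InSubfield q y → x^q-x y ≡ 0#
    x^q-x-root y y^q≡y = begin
      y * (y ^ d + - 1#)   ≡⟨ solve 2 (λ y u → y :* (u :- con (+ 1)) := y :* u :- y) refl y (y ^ d) ⟩
      y * y ^ d + - y      ≡⟨ cong (_+ - y) y^q≡y ⟩
      y + - y              ≡⟨ -‿inverseʳ y ⟩
      0#                   ∎
      where open ≡-Reasoning

    root-InSubfield : ∀ y → x^q-x y ≡ 0# → InSubfield q y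
    root-InSubfield y root = begin
      y * y ^ d                  ≡⟨ solve 2 (λ y u → y :* u := y :* (u :- con (+ 1)) :+ y) refl y (y ^ d) ⟩
      y * (y ^ d + - 1#) + y     ≡⟨ cong (_+ y) root ⟩
      0# + y                     ≡⟨ +-identityˡ y ⟩
      y                          ∎
      where open ≡-Reasoning

    S : ℕ → F → F
    S zero    y = 1#
    S (suc j) y = y ^ d * S j y + 1#

    S-monic : ∀ j → Monic (j ℕ.* d) (S j)
    S-monic zero    = monic-1
    S-monic (suc j) = monic-+-const (monic-X^* (S-monic j) d) 1#

    [x^d-1]*S : ∀ j y → (y ^ d + - 1#) * S j y ≡ y ^ (suc j ℕ.* d) + - 1#
    [x^d-1]*S zero    y = trans (*-identityʳ _) (cong (λ u → u + - 1#) (sym (trans (^-+ y d 0) (*-identityʳ _))))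
    [x^d-1]*S (suc j) y = begin
      (u + - 1#) * (u * S j y + 1#)      ≡⟨ solve 2 (λ u s → (u :- con (+ 1)) :* (u :* s :+ con (+ 1))
                                                := u :* ((u :- con (+ 1)) :* s) :+ (u :- con (+ 1))) refl u (S j y) ⟩
      u * ((u + - 1#) * S j y) + (u + - 1#)  ≡⟨ cong (λ v → u * v + (u + - 1#)) ([x^d-1]*S j y) ⟩
      u * (y ^ (suc j ℕ.* d) + - 1#) + (u + - 1#)  ≡⟨ solve 2 (λ u v → u :* (v :- con (+ 1)) :+ (u :- con (+ 1)) := u :* v :- con (+ 1))
                                                         refl u (y ^ (suc j ℕ.* d)) ⟩
      u * y ^ (suc j ℕ.* d) + - 1#       ≡⟨ cong (_+ - 1#) (sym (^-+ y d (suc j ℕ.* d))) ⟩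
      y ^ (suc (suc j) ℕ.* d) + - 1#     ∎
      where
      open ≡-Reasoning
      u = y ^ d

  -- Every element is a root of x^card - x = (x^q - x) · S, where S has degree card - q.
  subfield-card : ∀ {q n} → 1 < q → 1 ≤ n → card ≡ q ℕ.^ n → count (InSubfield? q) ≡ q
  subfield-card {suc zero} (s≤s ()) _ _
  subfield-card {suc (suc d′)} {suc n} _ _ card≡q^1+n with 1+d^1+e≡1+multiple (suc d′) n
  ... | m , q^1+n≡1+[1+m]d = ℕ.≤-antisym
    (ℕ.≤-trans (count-mono (InSubfield? q) roots? (λ {y} → x^q-x-root y)) (count-roots≤degree x^q-x-monic))
    (ℕ.≤-trans q≤count-roots (count-mono roots? (InSubfield? q) (λ {y} → root-InSubfield y)))
    where
    open X^q-X d′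
    x^q-x*S≡0 : ∀ y → x^q-x y * S m y ≡ 0#
    x^q-x*S≡0 y = begin
      y * (y ^ d + - 1#) * S m y         ≡⟨ *-assoc y _ _ ⟩
      y * ((y ^ d + - 1#) * S m y)       ≡⟨ cong (y *_) ([x^d-1]*S m y) ⟩
      y * (y ^ (suc m ℕ.* d) + - 1#)     ≡⟨ solve 2 (λ y u → y :* (u :- con (+ 1)) := y :* u :- y) refl y _ ⟩
      y ^ suc (suc m ℕ.* d) + - y        ≡⟨ cong (λ e → y ^ e + - y) (sym (trans card≡q^1+n q^1+n≡1+[1+m]d)) ⟩
      y ^ card + - y                     ≡⟨ cong (_+ - y) (fermat y) ⟩
      y + - y                            ≡⟨ -‿inverseʳ y ⟩
      0#                                 ∎
      where open ≡-Reasoning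

    q≤count-roots : q ≤ count roots?
    q≤count-roots = ℕ.+-cancelʳ-≤ (m ℕ.* d) q (count roots?) (begin
      q ℕ.+ m ℕ.* d                          ≡⟨ sym (trans card≡q^1+n q^1+n≡1+[1+m]d) ⟩
      card                                   ≤⟨ card≤count+count roots? (λ y → S m y ≟ 0#)
                                                  (λ y → x*y≡0⇒x≡0⊎y≡0 (x^q-x*S≡0 y)) ⟩
      count roots? ℕ.+ count (λ y → S m y ≟ 0#)  ≤⟨ ℕ.+-monoʳ-≤ (count roots?) (count-roots≤degree (S-monic m)) ⟩
      count roots? ℕ.+ m ℕ.* d               ∎)
      where open ℕ.≤-Reasoning


module Frobenius (K : FiniteField) (q t : ℕ) (card≡q^3t : FiniteField.card K ≡ q ℕ.^ (3 ℕ.* t)) where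
  open FieldArithmetic K
  open Fermat K using (fermat)

  Q : ℕ
  Q = q ℕ.^ t

  φ : F → F
  φ w = w ^ Q

  ^q^[t+r] : ∀ w r → w ^ (q ℕ.^ (t ℕ.+ r)) ≡ φ w ^ (q ℕ.^ r)
  ^q^[t+r] w r = trans (cong (w ^_) (ℕ.^-distribˡ-+-* q t r)) (^-* w Q (q ℕ.^ r))

  ^q^[t+0] : ∀ w → w ^ (q ℕ.^ (t ℕ.+ 0)) ≡ φ w
  ^q^[t+0] w = cong (λ e → w ^ (q ℕ.^ e)) (ℕ.+-identityʳ t)

  ^q^2t≡φ² : ∀ w → w ^ (q ℕ.^ (2 ℕ.* t)) ≡ φ (φ w)
  ^q^2t≡φ² w = trans (^q^[t+r] w (t ℕ.+ 0)) (^q^[t+0] (φ w))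

  φ³≡id : ∀ w → φ (φ (φ w)) ≡ w
  φ³≡id w = begin
    φ (φ (φ w))                                  ≡⟨ ^q^[t+0] (φ (φ w)) ⟨
    φ (φ w) ^ (q ℕ.^ (t ℕ.+ 0))                  ≡⟨ ^q^[t+r] (φ w) (t ℕ.+ 0) ⟨
    φ w ^ (q ℕ.^ (t ℕ.+ (t ℕ.+ 0)))              ≡⟨ ^q^[t+r] w (t ℕ.+ (t ℕ.+ 0)) ⟨
    w ^ (q ℕ.^ (3 ℕ.* t))                        ≡⟨ cong (w ^_) card≡q^3t ⟨
    w ^ card                                     ≡⟨ fermat w ⟩
    w                                            ∎
    where open ≡-Reasoning

  φ-* : ∀ u v → φ (u * v) ≡ φ u * φ v
  φ-* u v = *-^ u v Q

  φ-^ : ∀ w n → φ (w ^ n) ≡ φ w ^ n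
  φ-^ w n = ^-comm w n Q

  norm : F → F
  norm w = w * φ w * φ (φ w)

  N3≡norm : ∀ w → N3 q t w ≡ norm w
  N3≡norm w = trans (^-+ w (suc Q) (q ℕ.^ (2 ℕ.* t))) (cong (w ^ suc Q *_) (^q^2t≡φ² w))

  norm-* : ∀ u v → norm (u * v) ≡ norm u * norm v
  norm-* u v = begin
    u * v * φ (u * v) * φ (φ (u * v))           ≡⟨ cong₂ (λ a b → u * v * a * b) (φ-* u v)
                                                         (trans (cong φ (φ-* u v)) (φ-* _ _)) ⟩
    u * v * (φ u * φ v) * (φ (φ u) * φ (φ v))   ≡⟨ solve 6 (λ u v a b c d → u :* v :* (a :* b) :* (c :* d)
                                                                        := u :* a :* c :* (v :* b :* d))
                                                      refl u v (φ u) (φ v) (φ (φ u)) (φ (φ v)) ⟩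
    norm u * norm v                             ∎
    where open ≡-Reasoning

  norm-φ² : ∀ w → norm (φ (φ w)) ≡ norm w
  norm-φ² w = trans (cong₂ (λ a b → φ (φ w) * a * b) (φ³≡id w) (cong φ (φ³≡id w)))
    (solve 3 (λ a b c → c :* a :* b := a :* b :* c) refl w (φ w) (φ (φ w)))

  norm-[-1] : norm (- 1#) ≡ - 1#
  norm-[-1] with n+n*n-even Q
  ... | k , Q+QQ≡k+k = begin
    norm (- 1#)                           ≡⟨ N3≡norm (- 1#) ⟨
    - 1# * (- 1#) ^ (Q ℕ.+ q ℕ.^ (2 ℕ.* t))  ≡⟨ cong (λ e → - 1# * (- 1#) ^ (Q ℕ.+ e)) q^2t≡Q*Q ⟩
    - 1# * (- 1#) ^ (Q ℕ.+ Q ℕ.* Q)        ≡⟨ cong (λ e → - 1# * (- 1#) ^ e) Q+QQ≡k+k ⟩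
    - 1# * (- 1#) ^ (k ℕ.+ k)             ≡⟨ cong (- 1# *_) (-1^[k+k] k) ⟩
    - 1# * 1#                             ≡⟨ *-identityʳ _ ⟩
    - 1#                                  ∎
    where
    open ≡-Reasoning
    q^2t≡Q*Q : q ℕ.^ (2 ℕ.* t) ≡ Q ℕ.* Q
    q^2t≡Q*Q = trans (ℕ.^-distribˡ-+-* q t (t ℕ.+ 0)) (cong (λ e → Q ℕ.* q ℕ.^ e) (ℕ.+-identityʳ t))


module DoubleCounting (K : FiniteField) where
  open FieldArithmetic K
  open Counting K
  open ListCounting
  open import Data.List.Properties using (filter-none)

  module Incidence {T : Pred F 0ℓ} (T? : Decidable T) (f : F → F) (f-≢0 : ∀ {x} → x ≢ 0# → f x ≢ 0#) where

    Hits : F → F → Set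
    Hits z x = x ≢ 0# × T (z * f x * x ⁻¹)

    Hits? : ∀ z → Decidable (Hits z)
    Hits? z x = ≢0? x ×-dec T? (z * f x * x ⁻¹)

    row column : F → ℕ
    row z    = count (Hits? z)
    column x = count (λ z → Hits? z x)

    τ : ℕ
    τ = count T?

    column-≢0 : ∀ {x} → x ≢ 0# → column x ≡ τ
    column-≢0 {x} x≢0 = ℕ.≤-antisym column≤τ τ≤column
      where
      fx≢0 = f-≢0 x≢0
      column≤τ : column x ≤ τ
      column≤τ = count-≤-injection (λ z → Hits? z x) T? (λ z → z * f x * x ⁻¹)
        (λ eq → *-cancelʳ fx≢0 (*-cancelʳ (⁻¹-≢0 x≢0) eq)) proj₂
      back : ∀ w → w * x * f x ⁻¹ * f x * x ⁻¹ ≡ w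
      back w = trans (cong (_* x ⁻¹) (x*y⁻¹*y≡x (w * x) fx≢0)) (x*y*y⁻¹≡x w x≢0)
      τ≤column : τ ≤ column x
      τ≤column = count-≤-injection T? (λ z → Hits? z x) (λ w → w * x * f x ⁻¹)
        (λ eq → *-cancelʳ x≢0 (*-cancelʳ (⁻¹-≢0 fx≢0) eq))
        (λ {w} Tw → x≢0 , subst T (sym (back w)) Tw)

    column-0 : column 0# ≡ 0
    column-0 = cong length (filter-none (λ z → Hits? z 0#) {elems} (All.tabulate (λ _ hit → proj₁ hit refl)))

    units-τ : F → ℕ
    units-τ x = indicator ≢0? x ℕ.* τ

    units-τ-≢0 : ∀ {x} → x ≢ 0# → units-τ x ≡ τ
    units-τ-≢0 x≢0 = trans (cong (ℕ._* τ) (indicator-yes ≢0? x≢0)) (ℕ.+-identityʳ τ)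

    units-τ-0 : units-τ 0# ≡ 0
    units-τ-0 = cong (ℕ._* τ) (indicator-no ≢0? (λ 0≢0 → 0≢0 refl))

    column≡units-τ : ∀ x → column x ≡ units-τ x
    column≡units-τ x = by-cases (x ≟ 0#)
      where
      by-cases : Dec (x ≡ 0#) → column x ≡ units-τ x
      by-cases (yes refl) = trans column-0 (sym units-τ-0)
      by-cases (no x≢0)   = trans (column-≢0 x≢0) (sym (units-τ-≢0 x≢0))

    ∑-row≡∑-units-τ : ∑ elems row ≡ ∑ elems units-τ
    ∑-row≡∑-units-τ = begin
      ∑ elems row                                          ≡⟨ ∑-cong elems (λ z → length-filter≡∑-indicator (Hits? z) elems) ⟩
      ∑ elems (λ z → ∑ elems (λ x → indicator (Hits? z) x))  ≡⟨ ∑-swap elems elems (λ z x → indicator (Hits? z) x) ⟩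
      ∑ elems (λ x → ∑ elems (λ z → indicator (Hits? z) x))  ≡⟨ ∑-cong elems (λ x →
                                                                  sym (length-filter≡∑-indicator (λ z → Hits? z x) elems)) ⟩
      ∑ elems column                                       ≡⟨ ∑-cong elems column≡units-τ ⟩
      ∑ elems units-τ                                      ∎
      where open ≡-Reasoning

    -- Every column of the incidence relation has exactly τ entries, so rows of size ≥ τ have size exactly τ.
    rows-tight : (∀ {z} → z ≢ 0# → τ ≤ row z) → ∀ {z} → z ≢ 0# → row z ≤ τ
    rows-tight τ≤row {z} z≢0 = subst (row z ≤_) (units-τ-≢0 z≢0)
      (∑-tight elems units-τ≤row (ℕ.≤-reflexive ∑-row≡∑-units-τ) (complete z))
      where
      units-τ≤row : ∀ z → units-τ z ≤ row z
      units-τ≤row z = by-cases (z ≟ 0#)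
        where
        by-cases : Dec (z ≡ 0#) → units-τ z ≤ row z
        by-cases (yes refl) = ℕ.≤-trans (ℕ.≤-reflexive units-τ-0) z≤n
        by-cases (no z≢0)   = ℕ.≤-trans (ℕ.≤-reflexive (units-τ-≢0 z≢0)) (τ≤row z≢0)


module BinomialLinearSet (K : FiniteField) (q t i : ℕ) (card≡q^3t : FiniteField.card K ≡ q ℕ.^ (3 ℕ.* t)) where
  open FieldArithmetic K
  open Counting K
  open Subfields K
  open Frobenius K q t card≡q^3t

  qⁱ : ℕ
  qⁱ = q ℕ.^ i

  fLin-scale : ∀ c a b x → fLin q t i (c * a) (c * b) x ≡ c * fLin q t i a b x
  fLin-scale c a b x = solve 5 (λ c a b u v → c :* a :* u :+ c :* b :* v := c :* (a :* u :+ b :* v))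
    refl c a b (x ^ qⁱ) (x ^ (q ℕ.^ (2 ℕ.* t ℕ.+ i)))

  fLin≡ : ∀ a b x → fLin q t i a b x ≡ a * x ^ qⁱ + b * φ (φ (x ^ qⁱ))
  fLin≡ a b x = cong (λ u → a * x ^ qⁱ + b * u) (begin
    x ^ (q ℕ.^ (2 ℕ.* t ℕ.+ i))         ≡⟨ cong (x ^_) (ℕ.^-distribˡ-+-* q (2 ℕ.* t) i) ⟩
    x ^ (q ℕ.^ (2 ℕ.* t) ℕ.* qⁱ)        ≡⟨ cong (x ^_) (ℕ.*-comm (q ℕ.^ (2 ℕ.* t)) qⁱ) ⟩
    x ^ (qⁱ ℕ.* q ℕ.^ (2 ℕ.* t))        ≡⟨ ^-* x qⁱ (q ℕ.^ (2 ℕ.* t)) ⟩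
    (x ^ qⁱ) ^ (q ℕ.^ (2 ℕ.* t))        ≡⟨ ^q^2t≡φ² (x ^ qⁱ) ⟩
    φ (φ (x ^ qⁱ))                       ∎)
    where open ≡-Reasoning

  -- A zero x ≢ 0 gives a = - b φ²(z) / z with z = x^qⁱ, and norms turn this into N a = - N b.
  fLin-≢0 : ∀ {a b} → N3 q t a ≢ - N3 q t b → ∀ {x} → x ≢ 0# → fLin q t i a b x ≢ 0#
  fLin-≢0 {a} {b} Na≢-Nb {x} x≢0 fx≡0 = Na≢-Nb (begin
    N3 q t a        ≡⟨ N3≡norm a ⟩
    norm a          ≡⟨ *-cancelʳ norm-z≢0 norm-a*norm-z≡ ⟩
    - norm b        ≡⟨ cong -_ (N3≡norm b) ⟨
    - N3 q t b      ∎)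
    where
    open ≡-Reasoning
    z w : F
    z = x ^ qⁱ
    w = φ (φ z)
    norm-z≢0 : norm z ≢ 0#
    norm-z≢0 = subst (_≢ 0#) (N3≡norm z) (^-≢0 (1 ℕ.+ Q ℕ.+ q ℕ.^ (2 ℕ.* t)) (^-≢0 qⁱ x≢0))
    a*z≡-1*[b*w] : a * z ≡ - 1# * (b * w)
    a*z≡-1*[b*w] = begin
      a * z                        ≡⟨ solve 2 (λ u v → u := (u :+ v) :+ (:- con (+ 1)) :* v) refl (a * z) (b * w) ⟩
      (a * z + b * w) + - 1# * (b * w)  ≡⟨ cong (λ u → u + - 1# * (b * w)) (trans (sym (fLin≡ a b x)) fx≡0) ⟩
      0# + - 1# * (b * w)           ≡⟨ +-identityˡ _ ⟩
      - 1# * (b * w)                ∎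
    norm-a*norm-z≡ : norm a * norm z ≡ - norm b * norm z
    norm-a*norm-z≡ = begin
      norm a * norm z                  ≡⟨ norm-* a z ⟨
      norm (a * z)                     ≡⟨ cong norm a*z≡-1*[b*w] ⟩
      norm (- 1# * (b * w))            ≡⟨ trans (norm-* (- 1#) (b * w)) (cong (norm (- 1#) *_) (norm-* b w)) ⟩
      norm (- 1#) * (norm b * norm w)  ≡⟨ cong₂ (λ u v → u * (norm b * v)) norm-[-1] (norm-φ² z) ⟩
      - 1# * (norm b * norm z)         ≡⟨ solve 2 (λ u v → (:- con (+ 1)) :* (u :* v) := :- u :* v) refl (norm b) (norm z) ⟩
      - norm b * norm z                ∎

  fLin-homogeneous : ∀ a b {μ} x → InSubfield Q μ → fLin q t i a b (μ * x) ≡ μ ^ qⁱ * fLin q t i a b x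
  fLin-homogeneous a b {μ} x φμ≡μ = begin
    fLin q t i a b (μ * x)                                  ≡⟨ fLin≡ a b (μ * x) ⟩
    a * (μ * x) ^ qⁱ + b * φ (φ ((μ * x) ^ qⁱ))             ≡⟨ cong (λ u → a * u + b * φ (φ u)) (*-^ μ x qⁱ) ⟩
    a * (m * x ^ qⁱ) + b * φ (φ (m * x ^ qⁱ))               ≡⟨ cong (λ u → a * (m * x ^ qⁱ) + b * u) (trans (cong φ (φ-* _ _)) (φ-* _ _)) ⟩
    a * (m * x ^ qⁱ) + b * (φ (φ m) * φ (φ (x ^ qⁱ)))       ≡⟨ cong (λ u → a * (m * x ^ qⁱ) + b * (u * φ (φ (x ^ qⁱ)))) φ²m≡m ⟩
    a * (m * x ^ qⁱ) + b * (m * φ (φ (x ^ qⁱ)))             ≡⟨ solve 5 (λ a b m u v → a :* (m :* u) :+ b :* (m :* v) := m :* (a :* u :+ b :* v))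
                                                                 refl a b m (x ^ qⁱ) (φ (φ (x ^ qⁱ))) ⟩
    m * (a * x ^ qⁱ + b * φ (φ (x ^ qⁱ)))                   ≡⟨ cong (m *_) (fLin≡ a b x) ⟨
    m * fLin q t i a b x                                    ∎
    where
    open ≡-Reasoning
    m = μ ^ qⁱ
    φm≡m : φ m ≡ m
    φm≡m = trans (φ-^ μ qⁱ) (cong (_^ qⁱ) φμ≡μ)
    φ²m≡m : φ (φ m) ≡ m
    φ²m≡m = trans (cong φ φm≡m) φm≡m

  Fₜˣ : Pred F 0ℓ
  Fₜˣ μ = μ ≢ 0# × InSubfield Q μ

  Fₜˣ? : Decidable Fₜˣ
  Fₜˣ? μ = ≢0? μ ×-dec InSubfield? Q μ

  Fₜˣ-* : ∀ {u v} → Fₜˣ u → Fₜˣ v → Fₜˣ (u * v)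
  Fₜˣ-* (u≢0 , φu≡u) (v≢0 , φv≡v) = *-≢0 u≢0 v≢0 , trans (φ-* _ _) (cong₂ _*_ φu≡u φv≡v)

  Fₜˣ-⁻¹ : ∀ {μ} → Fₜˣ μ → Fₜˣ (μ ⁻¹)
  Fₜˣ-⁻¹ (μ≢0 , φμ≡μ) = ⁻¹-≢0 μ≢0 , trans (⁻¹-^ Q μ≢0) (cong _⁻¹ φμ≡μ)

  Fₜˣ-^ : ∀ {μ} n → Fₜˣ μ → Fₜˣ (μ ^ n)
  Fₜˣ-^ n (μ≢0 , φμ≡μ) = ^-≢0 n μ≢0 , trans (φ-^ _ n) (cong (_^ n) φμ≡μ)

  Fₜˣ-1 : Fₜˣ 1#
  Fₜˣ-1 = 1≢0 , 1^ Q

  module _ {a b : F} (Na≢-Nb : N3 q t a ≢ - N3 q t b) where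

    f : F → F
    f = fLin q t i a b

    open DoubleCounting.Incidence K Fₜˣ? f (fLin-≢0 Na≢-Nb)

    HasSubfieldRatio : F → Set
    HasSubfieldRatio c = Σ F λ x → x ≢ 0# × Σ F λ y → InSubfield Q y × fLin q t i (c * a) (c * b) x ≡ y * x

    HasSubfieldRatio? : Decidable HasSubfieldRatio
    HasSubfieldRatio? c =
      ∃? λ x → ≢0? x ×-dec ∃? λ y → InSubfield? Q y ×-dec (fLin q t i (c * a) (c * b) x ≟ (y * x))

    orbit⊆row : ∀ {z x y μ} → x ≢ 0# → Fₜˣ y → z * f x ≡ y * x → Fₜˣ μ → Hits z (μ * x)
    orbit⊆row {z} {x} {y} {μ} x≢0 Fy zfx≡yx Fμ@(μ≢0 , φμ≡μ) =
      *-≢0 μ≢0 x≢0 , subst Fₜˣ (sym hit≡) (Fₜˣ-* (Fₜˣ-* (Fₜˣ-^ qⁱ Fμ) (Fₜˣ-⁻¹ Fμ)) Fy)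
      where
      open ≡-Reasoning
      hit≡ : z * f (μ * x) * (μ * x) ⁻¹ ≡ μ ^ qⁱ * μ ⁻¹ * y
      hit≡ = begin
        z * f (μ * x) * (μ * x) ⁻¹              ≡⟨ cong₂ (λ u v → z * u * v) (fLin-homogeneous a b x φμ≡μ) (⁻¹-* μ≢0 x≢0) ⟩
        z * (μ ^ qⁱ * f x) * (μ ⁻¹ * x ⁻¹)      ≡⟨ solve 5 (λ z m u v w → z :* (m :* u) :* (v :* w) := m :* v :* (z :* u) :* w)
                                                     refl z (μ ^ qⁱ) (f x) (μ ⁻¹) (x ⁻¹) ⟩
        μ ^ qⁱ * μ ⁻¹ * (z * f x) * x ⁻¹        ≡⟨ cong (λ u → μ ^ qⁱ * μ ⁻¹ * u * x ⁻¹) zfx≡yx ⟩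
        μ ^ qⁱ * μ ⁻¹ * (y * x) * x ⁻¹          ≡⟨ solve 4 (λ m y x u → m :* (y :* x) :* u := m :* y :* (x :* u))
                                                     refl (μ ^ qⁱ * μ ⁻¹) y x (x ⁻¹) ⟩
        μ ^ qⁱ * μ ⁻¹ * y * (x * x ⁻¹)          ≡⟨ cong (μ ^ qⁱ * μ ⁻¹ * y *_) (x*x⁻¹≡1 x≢0) ⟩
        μ ^ qⁱ * μ ⁻¹ * y * 1#                  ≡⟨ *-identityʳ _ ⟩
        μ ^ qⁱ * μ ⁻¹ * y                       ∎

    τ≤count-orbit : ∀ {x} → x ≢ 0# → τ ≤ count (λ y → Fₜˣ? (y * x ⁻¹))
    τ≤count-orbit {x} x≢0 = count-≤-injection Fₜˣ? (λ y → Fₜˣ? (y * x ⁻¹)) (_* x) (*-cancelʳ x≢0)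
      (λ {μ} Fμ → subst Fₜˣ (sym (x*y*y⁻¹≡x μ x≢0)) Fμ)

    module _ (all-have-ratio : ∀ {c} → c ≢ 0# → HasSubfieldRatio c) where

      τ≤row : ∀ {z} → z ≢ 0# → τ ≤ row z
      τ≤row {z} z≢0 with all-have-ratio z≢0
      ... | x , x≢0 , y , φy≡y , fzx≡yx = count-≤-injection Fₜˣ? (Hits? z) (_* x) (*-cancelʳ x≢0)
        (orbit⊆row x≢0 (y≢0 , φy≡y) zfx≡yx)
        where
        zfx≡yx : z * f x ≡ y * x
        zfx≡yx = trans (sym (fLin-scale z a b x)) fzx≡yx
        y≢0 : y ≢ 0#
        y≢0 y≡0 = *-≢0 z≢0 (fLin-≢0 Na≢-Nb x≢0) (trans zfx≡yx (trans (cong (_* x) y≡0) (zeroˡ x)))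

      -- The row of z = x f(x)⁻¹ contains the τ points of 𝔽_{q^t}ˣ · x, hence nothing else.
      row⊆orbit : ∀ {x} → x ≢ 0# → ∀ {y} → Hits (x * f x ⁻¹) y → Fₜˣ (y * x ⁻¹)
      row⊆orbit {x} x≢0 = count-mono-tight (λ y → Fₜˣ? (y * x ⁻¹)) (Hits? z) orbit⊆row′
        (ℕ.≤-trans (rows-tight τ≤row z≢0) (τ≤count-orbit x≢0))
        where
        fx≢0 = fLin-≢0 Na≢-Nb x≢0
        z = x * f x ⁻¹
        z≢0 : z ≢ 0#
        z≢0 = *-≢0 x≢0 (⁻¹-≢0 fx≢0)
        zfx≡1x : z * f x ≡ 1# * x
        zfx≡1x = trans (x*y⁻¹*y≡x x fx≢0) (sym (*-identityˡ x))
        orbit⊆row′ : ∀ {y} → Fₜˣ (y * x ⁻¹) → Hits z y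
        orbit⊆row′ {y} F[y/x] = subst (Hits z) (x*y⁻¹*y≡x y x≢0) (orbit⊆row x≢0 Fₜˣ-1 zfx≡1x F[y/x])

      point⊆subfield : gcd i t ≡ 1 → 0 < q → ∀ {x y} → x ≢ 0# → f y * x ≡ f x * y → InSubfield q (y * x ⁻¹)
      point⊆subfield gcd≡1 0<q {x} {y} x≢0 fy*x≡fx*y with y ≟ 0#
      ... | yes refl = subst (InSubfield q) (sym (zeroˡ _)) (0∈subfield 0<q)
      ... | no  y≢0  = subfield-∩ {q} {i} {t} gcd≡1 μ^qⁱ≡μ φμ≡μ
        where
        open ≡-Reasoning
        fx≢0 = fLin-≢0 Na≢-Nb x≢0
        μ = y * x ⁻¹
        μ*x≡y : μ * x ≡ y
        μ*x≡y = x*y⁻¹*y≡x y x≢0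
        hit : Hits (x * f x ⁻¹) y
        hit = y≢0 , subst Fₜˣ (sym (begin
          x * f x ⁻¹ * f y * y ⁻¹        ≡⟨ solve 5 (λ x u v y w → x :* u :* v :* w := u :* (v :* x) :* w)
                                              refl x (f x ⁻¹) (f y) y (y ⁻¹) ⟩
          f x ⁻¹ * (f y * x) * y ⁻¹      ≡⟨ cong (λ v → f x ⁻¹ * v * y ⁻¹) fy*x≡fx*y ⟩
          f x ⁻¹ * (f x * y) * y ⁻¹      ≡⟨ solve 4 (λ u v y w → u :* (v :* y) :* w := (v :* u) :* (y :* w))
                                              refl (f x ⁻¹) (f x) y (y ⁻¹) ⟩
          (f x * f x ⁻¹) * (y * y ⁻¹)    ≡⟨ cong₂ _*_ (x*x⁻¹≡1 fx≢0) (x*x⁻¹≡1 y≢0) ⟩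
          1# * 1#                        ≡⟨ *-identityʳ 1# ⟩
          1#                             ∎)) Fₜˣ-1
        φμ≡μ : InSubfield Q μ
        φμ≡μ = proj₂ (row⊆orbit x≢0 hit)
        μ^qⁱ≡μ : μ ^ qⁱ ≡ μ
        μ^qⁱ≡μ = *-cancelʳ fx≢0 (*-cancelʳ x≢0 (begin
          μ ^ qⁱ * f x * x     ≡⟨ cong (_* x) (fLin-homogeneous a b x φμ≡μ) ⟨
          f (μ * x) * x        ≡⟨ cong (λ u → f u * x) μ*x≡y ⟩
          f y * x              ≡⟨ fy*x≡fx*y ⟩
          f x * y              ≡⟨ cong (f x *_) μ*x≡y ⟨
          f x * (μ * x)        ≡⟨ solve 3 (λ u m x → u :* (m :* x) := m :* u :* x) refl (f x) μ x ⟩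
          μ * f x * x          ∎))

      subfield⊆point : ∀ {x ν} → InSubfield q ν → f (ν * x) * x ≡ f x * (ν * x)
      subfield⊆point {x} {ν} ν^q≡ν = begin
        f (ν * x) * x          ≡⟨ cong (_* x) (fLin-homogeneous a b x (subfield-⊆ ν^q≡ν t)) ⟩
        ν ^ qⁱ * f x * x       ≡⟨ cong (λ u → u * f x * x) (subfield-⊆ ν^q≡ν i) ⟩
        ν * f x * x            ≡⟨ solve 3 (λ n u x → n :* u :* x := u :* (n :* x)) refl ν (f x) x ⟩
        f x * (ν * x)          ∎
        where open ≡-Reasoning

      scattered : 1 < q → 1 ≤ t → gcd i t ≡ 1 → Scattered q f
      scattered 1<q 1≤t gcd≡1 x x≢0 = ℕ.≤-antisym
        (ℕ.≤-trans (count-≤-injection point? (InSubfield? q) (_* x ⁻¹) (*-cancelʳ (⁻¹-≢0 x≢0))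
                      (point⊆subfield gcd≡1 (ℕ.<-trans (s≤s z≤n) 1<q) x≢0)) (ℕ.≤-reflexive |Fq|≡q))
        (ℕ.≤-trans (ℕ.≤-reflexive (sym |Fq|≡q))
                   (count-≤-injection (InSubfield? q) point? (_* x) (*-cancelʳ x≢0) subfield⊆point))
        where
        point? : Decidable (λ y → f y * x ≡ f x * y)
        point? y = (f y * x) ≟ (f x * y)
        |Fq|≡q : count (InSubfield? q) ≡ q
        |Fq|≡q = subfield-card 1<q (ℕ.≤-trans 1≤t (ℕ.m≤n*m t 3)) card≡q^3t

    not-scattered⇒∃c : 1 < q → 1 ≤ t → gcd i t ≡ 1 → ¬ Scattered q f →
      Σ F λ c → c ≢ 0# × (∀ x → x ≢ 0# → ∀ y → InSubfield Q y → fLin q t i (c * a) (c * b) x ≢ y * x)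
    not-scattered⇒∃c 1<q 1≤t gcd≡1 not-scattered with ∃? (λ c → ≢0? c ×-dec ¬? (HasSubfieldRatio? c))
    ... | yes (c , c≢0 , ¬ratio) = c , c≢0 , λ x x≢0 y y∈Fₜ fx≡yx → ¬ratio (x , x≢0 , y , y∈Fₜ , fx≡yx)
    ... | no ∄c = ⊥-elim (not-scattered (scattered all-have-ratio 1<q 1≤t gcd≡1))
      where
      all-have-ratio : ∀ {c} → c ≢ 0# → HasSubfieldRatio c
      all-have-ratio {c} c≢0 = decidable-stable (HasSubfieldRatio? c) (λ ¬ratio → ∄c (c , c≢0 , ¬ratio))


open import Data.Nat using (_^_; _*_)

prime-power>1 : ∀ {q} → IsPrimePower q → 1 < q
prime-power>1 (p , suc k , p-prime , _ , refl) =
  ℕ.<-≤-trans (nonTrivial⇒n>1 p) (ℕ.m≤m*n p (p ℕ.^ k) {{ℕ.m^n≢0 p k}})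
  where instance
    _ = prime⇒nonTrivial p-prime
    _ = prime⇒nonZero p-prime

lemma2p1 : (q : ℕ) → IsPrimePower q → (t : ℕ) → 1 ≤ t → (i : ℕ) → gcd i t ≡ 1 →
    (K : FiniteField) → FiniteField.card K ≡ q ^ (3 * t) →
    (a b : FiniteField.F K) → a ≢ FiniteField.0# K → b ≢ FiniteField.0# K →
    FiniteField.N3 K q t a ≢ FiniteField.-_ K (FiniteField.N3 K q t b) →
    ¬ FiniteField.Scattered K q (FiniteField.fLin K q t i a b) →
    Σ (FiniteField.F K) λ c → (c ≢ FiniteField.0# K) ×
      (∀ x → x ≢ FiniteField.0# K → ∀ y → FiniteField.InSubfield K (q ^ t) y →
        FiniteField.fLin K q t i (FiniteField._*_ K c a) (FiniteField._*_ K c b) x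
          ≢ FiniteField._*_ K y x)
lemma2p1 q q-prime-power t 1≤t i gcd≡1 K card≡q^3t a b _ _ Na≢-Nb =
  BinomialLinearSet.not-scattered⇒∃c K q t i card≡q^3t Na≢-Nb (prime-power>1 q-prime-power) 1≤t gcd≡1
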